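{- For all integers $k \ge 2$ and $v \ge 1$, $\kappa(A_{k,v},v) = k$.
   Context: All graphs are finite and simple. The claw number of a graph $G$ is the largest integer $v \ge 0$ such that the star $K_{1,v}$ is an induced subgraph of $G$. For $v \ge 1$, $\kappa(G,v)$ is the smallest number of parts in a partition of $V(G)$ into subsets each inducing a subgraph with claw number at most $v$. For $v \ge 1$, the graphs $A_{k,v}$ ($k \ge 1$) are defined recursively: $A_{1,v}$ is a single vertex; for $k \ge 2$, $A_{k,v}$ consists of $v+1$ vertex-disjoint copies of $A_{k-1,v}$ together with one new vertex adjacent to all vertices of these copies (and no other edges added). -}

module Defs where

open import Data.Nat using (ℕ; zero; suc; _≤_)
open import Data.Fin using (Fin)
open import Data.Product using (Σ; _×_; _,_)
open import Relation.Nullary using (¬_)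
open import Relation.Binary.PropositionalEquality using (_≡_; _≢_; refl)
open import Function.Definitions using (Injective)

record Graph : Set₁ where
  field
    V     : Set
    E     : V → V → Set
    sym   : ∀ {x y} → E x y → E y x
    irrefl : ∀ {x} → ¬ E x x

module _ (G : Graph) where
  open Graph G

  InducedStarIn : (S : V → Set) → ℕ → Set
  InducedStarIn S w =
    Σ V λ c → Σ (Fin w → V) λ f →
      S c × (∀ i → S (f i)) × Injective _≡_ _≡_ f
        × (∀ i → E c (f i)) × (∀ i j → i ≢ j → ¬ E (f i) (f j))

  ClawNumberAtMost : (S : V → Set) → ℕ → Set
  ClawNumberAtMost S v = ∀ w → InducedStarIn S w → w ≤ v

  -- V(G) can be partitioned into (at most) m parts (labelled by Fin m; empty
  -- parts allowed, which does not change the minimum) each inducing a subgraph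
  -- of claw number at most v.
  PartitionableInto : ℕ → ℕ → Set
  PartitionableInto v m =
    Σ (V → Fin m) λ col → ∀ i → ClawNumberAtMost (λ x → col x ≡ i) v

  κ≡ : ℕ → ℕ → Set
  κ≡ v k = PartitionableInto v k × (∀ m → PartitionableInto v m → k ≤ m)

-- Vertices of A_{k,v}: AVtx v k, for k ≥ 1 (AVtx v 0 is empty and unused).
data AVtx (v : ℕ) : ℕ → Set where
  root : ∀ {k} → AVtx v (suc k)
  sub  : ∀ {k} → Fin (suc v) → AVtx v (suc k) → AVtx v (suc (suc k))

data AAdj (v : ℕ) : ∀ {k} → AVtx v k → AVtx v k → Set where
  root-sub : ∀ {k} {i} {x : AVtx v (suc k)} → AAdj v root (sub i x)
  sub-root : ∀ {k} {i} {x : AVtx v (suc k)} → AAdj v (sub i x) root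
  sub-sub  : ∀ {k} {i} {x y : AVtx v (suc k)} → AAdj v x y → AAdj v (sub i x) (sub i y)

AAdj-sym : ∀ {v k} {x y : AVtx v k} → AAdj v x y → AAdj v y x
AAdj-sym root-sub = sub-root
AAdj-sym sub-root = root-sub
AAdj-sym (sub-sub e) = sub-sub (AAdj-sym e)

AAdj-irrefl : ∀ {v k} {x : AVtx v k} → ¬ AAdj v x x
AAdj-irrefl (sub-sub e) = AAdj-irrefl e

A : ℕ → ℕ → Graph
A k v = record
  { V = AVtx v k ; E = AAdj v ; sym = AAdj-sym ; irrefl = AAdj-irrefl }

-- Colouring every vertex by its depth gives k independent colour classes, so κ(A_{k,v},v) ≤ k.
-- Conversely, in a partition of A_{k+1,v} the colour c of the root cannot occur in all v+1
-- copies of A_{k,v}: one vertex of colour c from each copy, together with the root, would induce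
-- K_{1,v+1} in class c. Some copy therefore avoids c, it is coloured with the remaining colours,
-- and induction on k applies to it.
module Submission where

open import Defs
open import Data.Nat using (ℕ; zero; suc; _≤_; z≤n; s≤s)
open import Data.Nat.Properties using (1+n≰n)
open import Data.Fin using (Fin; zero; suc; punchOut; punchIn)
open import Data.Fin.Properties using (_≟_; suc-injective; any?; all?; ¬∀⟶∃¬; punchIn-punchOut)
open import Data.Product using (∃; _×_; _,_; proj₁; proj₂)
open import Data.Sum using (inj₁; inj₂)
open import Data.Empty using (⊥-elim)
open import Function using (_∘_)
open import Function.Definitions using (Injective)
open import Relation.Nullary using (¬_; Dec; yes; no)
open import Relation.Nullary.Decidable using (map′; _⊎-dec_)
open import Relation.Unary using (Decidable)
open import Relation.Binary.PropositionalEquality using (_≡_; _≢_; refl; sym; trans; cong)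

open Graph using (V; E)

record InducedEmbedding (G H : Graph) : Set where
  field
    embed         : V G → V H
    injective     : Injective _≡_ _≡_ embed
    preserves-adj : ∀ {x y} → E G x y → E H (embed x) (embed y)
    reflects-adj  : ∀ {x y} → E H (embed x) (embed y) → E G x y

module _ {G : Graph} where

  ClawNumberAtMost-mono : ∀ {S T : V G → Set} {v} →
    (∀ {x} → S x → T x) → ClawNumberAtMost G T v → ClawNumberAtMost G S v
  ClawNumberAtMost-mono S⊆T clawT w (c , f , Sc , Sf , inj , adj , nadj) =
    clawT w (c , f , S⊆T Sc , S⊆T ∘ Sf , inj , adj , nadj)

  independent⇒ClawNumberAtMost : ∀ {S : V G → Set} {v} →
    (∀ {x y} → S x → S y → ¬ E G x y) → ClawNumberAtMost G S v
  independent⇒ClawNumberAtMost indep zero    _                            = z≤n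
  independent⇒ClawNumberAtMost indep (suc w) (c , f , Sc , Sf , _ , adj , _) =
    ⊥-elim (indep Sc (Sf zero) (adj zero))

  PartitionableInto-dropColour : ∀ {v m} (col : V G → Fin (suc m)) (c : Fin (suc m)) →
    (∀ x → col x ≢ c) → (∀ i → ClawNumberAtMost G (λ x → col x ≡ i) v) →
    PartitionableInto G v m
  PartitionableInto-dropColour col c avoids good =
    col′ , λ j → ClawNumberAtMost-mono (class⊆ j) (good (punchIn c j))
    where
      col′ : V G → Fin _
      col′ x = punchOut (avoids x ∘ sym)

      class⊆ : ∀ j {x} → col′ x ≡ j → col x ≡ punchIn c j
      class⊆ j {x} eq = trans (sym (punchIn-punchOut (avoids x ∘ sym))) (cong (punchIn c) eq)

module _ {G H : Graph} (e : InducedEmbedding G H) where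
  open InducedEmbedding e

  InducedStarIn-embed : ∀ {S : V H → Set} {w} →
    InducedStarIn G (S ∘ embed) w → InducedStarIn H S w
  InducedStarIn-embed (c , f , Sc , Sf , inj , adj , nadj) =
    embed c , embed ∘ f , Sc , Sf , inj ∘ injective , preserves-adj ∘ adj ,
    λ i j i≢j → nadj i j i≢j ∘ reflects-adj

  PartitionableInto-restrict : ∀ {v m} → PartitionableInto H v m → PartitionableInto G v m
  PartitionableInto-restrict (col , good) =
    col ∘ embed , λ i w → good i w ∘ InducedStarIn-embed

module _ {v : ℕ} where

  depth : ∀ {k} → AVtx v k → Fin k
  depth root      = zero
  depth (sub _ x) = suc (depth x)

  depth-adj : ∀ {k} {x y : AVtx v k} → AAdj v x y → depth x ≢ depth y
  depth-adj root-sub    ()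
  depth-adj sub-root    ()
  depth-adj (sub-sub e) eq = depth-adj e (suc-injective eq)

  sub-injective : ∀ {k i j} {x y : AVtx v (suc k)} → sub i x ≡ sub j y → i ≡ j × x ≡ y
  sub-injective refl = refl , refl

  sub-adj⇒sameCopy : ∀ {k i j} {x y : AVtx v (suc k)} → AAdj v (sub i x) (sub j y) → i ≡ j
  sub-adj⇒sameCopy (sub-sub _) = refl

  sub-adj⁻ : ∀ {k i} {x y : AVtx v (suc k)} → AAdj v (sub i x) (sub i y) → AAdj v x y
  sub-adj⁻ (sub-sub e) = e

  copy : ∀ {k} → Fin (suc v) → InducedEmbedding (A (suc k) v) (A (suc (suc k)) v)
  copy i = record
    { embed         = sub i
    ; injective     = proj₂ ∘ sub-injective
    ; preserves-adj = sub-sub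
    ; reflects-adj  = sub-adj⁻
    }

  any?ᴬ : ∀ {k} {P : AVtx v (suc k) → Set} → Decidable P → Dec (∃ P)
  any?ᴬ {zero}  P? = map′ (root ,_) (λ { (root , p) → p }) (P? root)
  any?ᴬ {suc k} P? =
    map′ (λ { (inj₁ p) → root , p ; (inj₂ (i , x , p)) → sub i x , p })
         (λ { (root , p) → inj₁ p ; (sub i x , p) → inj₂ (i , x , p) })
         (P? root ⊎-dec any? (λ i → any?ᴬ (P? ∘ sub i)))

  rootStar : ∀ {k} {S : AVtx v (suc (suc k)) → Set} →
    S root → (∀ i → ∃ λ x → S (sub i x)) → InducedStarIn (A (suc (suc k)) v) S (suc v)
  rootStar Sroot hits =
    root , (λ i → sub i (proj₁ (hits i))) , Sroot , proj₂ ∘ hits ,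
    proj₁ ∘ sub-injective , (λ _ → root-sub) , λ i j i≢j → i≢j ∘ sub-adj⇒sameCopy

  copyAvoidingRootColour : ∀ {k m} (col : AVtx v (suc (suc k)) → Fin m) →
    (∀ i → ClawNumberAtMost (A (suc (suc k)) v) (λ x → col x ≡ i) v) →
    ∃ λ i → ∀ x → col (sub i x) ≢ col root
  copyAvoidingRootColour col good = decide (all? hits?)
    where
      Hits : Fin (suc v) → Set
      Hits i = ∃ λ x → col (sub i x) ≡ col root

      hits? : Decidable Hits
      hits? i = any?ᴬ (λ x → col (sub i x) ≟ col root)

      decide : Dec (∀ i → Hits i) → ∃ λ i → ∀ x → col (sub i x) ≢ col root
      decide (yes hits) = ⊥-elim (1+n≰n (good (col root) (suc v) (rootStar refl hits)))
      decide (no ¬hits) = let i , ¬hit = ¬∀⟶∃¬ _ Hits hits? ¬hits in i , λ x eq → ¬hit (x , eq)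

  depthPartition : ∀ k → PartitionableInto (A (suc k) v) v (suc k)
  depthPartition k =
    depth , λ _ → independent⇒ClawNumberAtMost {A (suc k) v} λ dx dy e → depth-adj e (trans dx (sym dy))

  partition-lowerBound : ∀ n m → PartitionableInto (A (suc n) v) v m → suc n ≤ m
  partition-lowerBound n       zero    (col , _) with col root
  ... | ()
  partition-lowerBound zero    (suc m) _ = s≤s z≤n
  partition-lowerBound (suc n) (suc m) (col , good) =
    let i , avoids = copyAvoidingRootColour col good
        col′ , good′ = PartitionableInto-restrict (copy i) (col , good)
    in  s≤s (partition-lowerBound n m
          (PartitionableInto-dropColour {A (suc n) v} col′ (col root) avoids good′))

-- The hypotheses only exclude k = 0; the argument works for every k ≥ 1 and every v.
lemma2 : (k v : ℕ) → 2 ≤ k → 1 ≤ v → κ≡ (A k v) v k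
lemma2 (suc n) v _ _ = depthPartition n , λ m → partition-lowerBound n m
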